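{- Let $(\mathbf{d}_n)_{n\ge1}$ be a family of degree sequences, $\mathbf{d}_n=(d_1,\dots,d_n)$, and let $v=v_n\in[n]$. Then, as $n\to\infty$, $$\mathbb{P}(\mathfrak{t}_n(v)=0)=O\Big(d_v\,\mathbb{E}[\mathfrak{s}_n(v)/n]+d_v\,n\,\mathbb{P}(\mathfrak{s}_n(v)>n/2)\Big).$$
   Context: A degree sequence is $(d_1,\dots,d_n)\in\mathbb{N}_0^n$ with $\sum_j d_j=n$. $F$ uniform on $\mathfrak{F}(\mathbf{d}_n)=\{f:[n]\to[n]: |f^{ -1}(\{i\})|=d_i\ \forall i\}$. Six-length: $\mathfrak{s}_f(v)=\min\{k\in\mathbb{N}: f^{(k)}(v)\in\{f^{(j)}(v):0\le j\le k-1\}\}$ ($f^{(k)}$ the $k$-fold composition, $f^{(0)}=\mathrm{id}$); tail-length $\mathfrak{t}_f(v)$ is the unique integer with $\mathfrak{t}_f(v)<\mathfrak{s}_f(v)$ and $f^{(\mathfrak{s}_f(v))}(v)=f^{(\mathfrak{t}_f(v))}(v)$; $\mathfrak{s}_n(v)=\mathfrak{s}_F(v)$, $\mathfrak{t}_n(v)=\mathfrak{t}_F(v)$. -}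

module Defs where

open import Data.Bool using (Bool; true; false; if_then_else_; _∧_)
open import Data.Nat using (ℕ; zero; suc; _+_; _*_; _<ᵇ_; _≡ᵇ_)
open import Data.Fin using (Fin; _≟_)
open import Data.Vec using (Vec; []; _∷_; lookup)
open import Data.List using (List; []; _∷_; [_]; map; concatMap; allFin; upTo; filterᵇ; length)
open import Data.Bool.ListAction using (and; any)
open import Data.Nat.ListAction using (sum)
open import Relation.Binary.PropositionalEquality using (_≡_)
open import Data.Integer using (+_)
open import Data.Rational using (ℚ; 0ℚ; _/_)
open import Relation.Nullary.Decidable using (⌊_⌋)

Map : ℕ → Set
Map n = Vec (Fin n) n

app : ∀ {n} → Map n → Fin n → Fin n
app f x = lookup f x

iter : ∀ {n} → Map n → ℕ → Fin n → Fin n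
iter f zero    x = x
iter f (suc k) x = app f (iter f k x)

allVecs : ∀ {n} k → List (Vec (Fin n) k)
allVecs {n} zero    = [ [] ]
allVecs {n} (suc k) = concatMap (λ x → map (x ∷_) (allVecs k)) (allFin n)

fiberSize : ∀ {n} → Map n → Fin n → ℕ
fiberSize {n} f i = length (filterᵇ (λ j → ⌊ app f j ≟ i ⌋) (allFin n))

hasDegrees : ∀ {n} → (Fin n → ℕ) → Map n → Bool
hasDegrees {n} d f = and (map (λ i → fiberSize f i ≡ᵇ d i) (allFin n))

-- 𝔉(d): all maps with prescribed in-degrees (as a list without repetition)
𝔉 : ∀ {n} → (Fin n → ℕ) → List (Map n)
𝔉 {n} d = filterᵇ (hasDegrees d) (allVecs n)

IsDegreeSeq : ∀ n → (Fin n → ℕ) → Set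
IsDegreeSeq n d = sum (map d (allFin n)) ≡ n

seenBefore : ∀ {n} → Map n → Fin n → ℕ → Bool
seenBefore f v k = any (λ j → ⌊ iter f j v ≟ iter f k v ⌋) (upTo k)

-- least k ≥ start with seenBefore, searched with fuel
-- (for start = 1 and fuel = n + 1 the minimum always exists by pigeonhole,
--  since among v, f v, …, f^(n) v two coincide)
searchSix : ∀ {n} → Map n → Fin n → ℕ → ℕ → ℕ
searchSix f v k zero       = k
searchSix f v k (suc fuel) = if seenBefore f v k then k else searchSix f v (suc k) fuel

six : ∀ {n} → Map n → Fin n → ℕ
six {n} f v = searchSix f v 1 (suc n)

searchTail : ∀ {n} → Map n → Fin n → ℕ → ℕ → ℕ → ℕ
searchTail f v s j zero       = j
searchTail f v s j (suc fuel) = if ⌊ iter f j v ≟ iter f s v ⌋ then j else searchTail f v s (suc j) fuel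

tailLen : ∀ {n} → Map n → Fin n → ℕ
tailLen f v = searchTail f v (six f v) 0 (six f v)

-- a / b as a rational (b = 0 never occurs below since 𝔉(d) ≠ ∅)
frac : ℕ → ℕ → ℚ
frac a zero    = 0ℚ
frac a (suc b) = (+ a) / suc b

Prob : ∀ {n} → (Fin n → ℕ) → (Map n → Bool) → ℚ
Prob d E = frac (length (filterᵇ E (𝔉 d))) (length (𝔉 d))

Expect : ∀ {n} → (Fin n → ℕ) → (Map n → ℕ) → ℚ
Expect d X = frac (sum (map X (𝔉 d))) (length (𝔉 d))

ExpectDiv : ∀ {n} → (Fin n → ℕ) → (Map n → ℕ) → ℕ → ℚ
ExpectDiv d X m = frac (sum (map X (𝔉 d))) (length (𝔉 d) * m)

probTail0 : ∀ {n} → (Fin n → ℕ) → Fin n → ℚ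
probTail0 d v = Prob d (λ f → tailLen f v ≡ᵇ 0)

probSixBig : ∀ {n} → (Fin n → ℕ) → Fin n → ℚ
probSixBig {n} d v = Prob d (λ f → n <ᵇ 2 * six f v)

expSixOverN : ∀ {n} → (Fin n → ℕ) → Fin n → ℚ
expSixOverN {n} d v = ExpectDiv d (λ f → six f v) n

-- Let v lie on a cycle of f ∈ 𝔉(d) of length s (so 𝔱 = 0). For each of
-- the n - s points w off that cycle, exchange the images of w and of f^(s-1)(v):
-- the result g ∈ 𝔉(d) has g(w) = v, keeps the injective orbit v, …, f^(s-1)(v),
-- and for fixed (s, w) this switch is an involution of 𝔉(d). Hence
--   n · #{f : 𝔱_f(v) = 0} ≤ Σ_f (#{w off the cycle} + s_f · d_v) ≤ Σ_g 𝔰_g(v) · d_v + d_v · Σ_f 𝔰_f(v),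
-- i.e. ℙ(𝔱_n(v) = 0) ≤ 2 d_v 𝔼[𝔰_n(v)/n] for every n: C = 2 and N = 0 suffice.

module Submission where

open import Defs
open import Level using (Level)
open import Function using (_∘_; id)
open import Data.Product using (∃-syntax; _×_; _,_; proj₁; proj₂; uncurry)
open import Data.Sum using (inj₁; inj₂)
open import Data.Empty using (⊥-elim)
open import Data.Unit using (tt)
open import Data.Bool using (Bool; true; false; T; not; _∧_; if_then_else_)
open import Data.Bool.ListAction using (and; or; all; any)
import Data.Nat as ℕ
open import Data.Nat using (ℕ; zero; suc; pred; _+_; _*_; _⊓_; _≤_; _<_; z≤n; s≤s; _≡ᵇ_)
open import Data.Nat.Properties hiding (_≟_; suc-injective)
open import Algebra.Properties.CommutativeSemigroup +-commutativeSemigroup using () renaming (interchange to +-interchange)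
open import Data.Nat.ListAction using (sum)
open import Data.Nat.ListAction.Properties using (sum-++)
open import Data.Fin as Fin using (Fin; _≟_)
open import Data.Fin.Properties using (suc-injective)
open import Data.Fin.Permutation.Components using (transpose)
open import Data.Vec as Vec using (Vec; _∷_)
open import Data.Vec.Properties using (lookup∘tabulate; tabulate-cong; tabulate∘lookup; ≡-dec; ∷-injective)
open import Data.List using (List; []; _∷_; map; concat; concatMap; filterᵇ; length; allFin; upTo; downFrom; _++_)
open import Data.List.Properties using (map-++; map-tabulate; length-tabulate; map-cong; length-map; length-upTo; map-cong-local)
open import Data.List.Relation.Unary.All.Properties using (all⁺; all⁻; applyUpTo⁺₁; applyUpTo⁻)
open import Data.List.Relation.Unary.Any.Properties using (any⁺)
open import Data.List.Membership.Propositional using (_∈_; lose)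
open import Data.List.Membership.Propositional.Properties using (∈-allFin; ∈-upTo⁺; ∈-map⁺)
open import Data.List.Relation.Unary.Any using (here; there)
import Data.List.Relation.Unary.All as All
import Data.Integer as ℤ
import Data.Integer.Properties as ℤ
import Data.Rational as ℚ
import Data.Rational.Properties as ℚ
import Data.Rational.Unnormalised as ℚᵘ
import Data.Rational.Unnormalised.Properties as ℚᵘ
open import Relation.Binary.Definitions using (DecidableEquality)
open import Relation.Binary.PropositionalEquality
open import Relation.Nullary using (¬_; Dec; yes; no; _×-dec_)
open import Relation.Nullary.Decidable using (⌊_⌋; T?; dec-true; dec-false; toWitness; fromWitness)

private variable
  a b : Level
  A B : Set a

T-∧-intro : ∀ x {y} → T x → T y → T (x ∧ y)
T-∧-intro true _ ty = ty

T-∧-elim : ∀ x {y} → T (x ∧ y) → T x × T y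
T-∧-elim true ty = tt , ty

T-not⇒¬T : ∀ {x} → T (not x) → ¬ T x
T-not⇒¬T {true} ()

¬T⇒T-not : ∀ {x} → ¬ T x → T (not x)
¬T⇒T-not {true}  ¬tt = ¬tt tt
¬T⇒T-not {false} _   = tt

𝟙 : Bool → ℕ
𝟙 true  = 1
𝟙 false = 0

𝟙-mono : ∀ {x y} → (T x → T y) → 𝟙 x ≤ 𝟙 y
𝟙-mono {false}         _ = z≤n
𝟙-mono {true} {true}   _ = ≤-refl
𝟙-mono {true} {false} x⇒y = ⊥-elim (x⇒y tt)

𝟙-dec-cong : ∀ {P : Set a} {Q : Set b} {p? : Dec P} {q? : Dec Q} →
             (P → Q) → (Q → P) → 𝟙 ⌊ p? ⌋ ≡ 𝟙 ⌊ q? ⌋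
𝟙-dec-cong {p? = yes p} {yes q}  _   _   = refl
𝟙-dec-cong {p? = yes p} {no ¬q}  p⇒q _   = ⊥-elim (¬q (p⇒q p))
𝟙-dec-cong {p? = no ¬p} {yes q}  _   q⇒p = ⊥-elim (¬p (q⇒p q))
𝟙-dec-cong {p? = no ¬p} {no ¬q}  _   _   = refl

𝟙-×-dec : ∀ {P : Set a} {Q : Set b} (p? : Dec P) (q? : Dec Q) →
          𝟙 ⌊ p? ×-dec q? ⌋ ≡ 𝟙 ⌊ p? ⌋ * 𝟙 ⌊ q? ⌋
𝟙-×-dec (yes p) (yes q) = refl
𝟙-×-dec (yes p) (no ¬q) = refl
𝟙-×-dec (no ¬p) q?      = refl

𝟙-∧ : ∀ x y → 𝟙 (x ∧ y) ≡ 𝟙 x * 𝟙 y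
𝟙-∧ false y = refl
𝟙-∧ true  y = sym (+-identityʳ (𝟙 y))

𝟙-T : ∀ {x} → T x → 𝟙 x ≡ 1
𝟙-T {true} _ = refl

𝟙-∧-T : ∀ {x} y → T x → 𝟙 (x ∧ y) ≡ 𝟙 y
𝟙-∧-T {true} y _ = refl

𝟙*≤ : ∀ x {m k} → (T x → m ≤ k) → 𝟙 x * m ≤ k
𝟙*≤ false _   = z≤n
𝟙*≤ true {m} m≤k = ≤-trans (≤-reflexive (+-identityʳ m)) (m≤k tt)

𝟙≤1 : ∀ x → 𝟙 x ≤ 1
𝟙≤1 true  = ≤-refl
𝟙≤1 false = z≤n

∑ : List A → (A → ℕ) → ℕ
∑ xs h = sum (map h xs)

syntax ∑ xs (λ x → e) = ∑[ x ← xs ] e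

∑-cong : ∀ (xs : List A) {g h : A → ℕ} → (∀ x → g x ≡ h x) → ∑ xs g ≡ ∑ xs h
∑-cong []       g≗h = refl
∑-cong (x ∷ xs) g≗h = cong₂ _+_ (g≗h x) (∑-cong xs g≗h)

∑-mono-≤ : ∀ (xs : List A) {g h : A → ℕ} → (∀ x → g x ≤ h x) → ∑ xs g ≤ ∑ xs h
∑-mono-≤ []       g≤h = z≤n
∑-mono-≤ (x ∷ xs) g≤h = +-mono-≤ (g≤h x) (∑-mono-≤ xs g≤h)

∑-zero : ∀ (xs : List A) → ∑[ x ← xs ] 0 ≡ 0
∑-zero []       = refl
∑-zero (x ∷ xs) = ∑-zero xs

∑-distrib-+ : ∀ (xs : List A) (g h : A → ℕ) → ∑[ x ← xs ] (g x + h x) ≡ ∑ xs g + ∑ xs h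
∑-distrib-+ []       g h = refl
∑-distrib-+ (x ∷ xs) g h =
  trans (cong (g x + h x +_) (∑-distrib-+ xs g h)) (+-interchange (g x) (h x) (∑ xs g) (∑ xs h))

∑-*ˡ : ∀ (xs : List A) c (h : A → ℕ) → ∑[ x ← xs ] (c * h x) ≡ c * ∑ xs h
∑-*ˡ []       c h = sym (*-zeroʳ c)
∑-*ˡ (x ∷ xs) c h = trans (cong (c * h x +_) (∑-*ˡ xs c h)) (sym (*-distribˡ-+ c (h x) (∑ xs h)))

∑-*ʳ : ∀ (xs : List A) c (h : A → ℕ) → ∑[ x ← xs ] (h x * c) ≡ ∑ xs h * c
∑-*ʳ xs c h = trans (∑-cong xs (λ x → *-comm (h x) c)) (trans (∑-*ˡ xs c h) (*-comm c (∑ xs h)))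

∑-comm : ∀ (xs : List A) (ys : List B) (h : A → B → ℕ) →
         ∑[ x ← xs ] ∑[ y ← ys ] h x y ≡ ∑[ y ← ys ] ∑[ x ← xs ] h x y
∑-comm []       ys h = sym (∑-zero ys)
∑-comm (x ∷ xs) ys h = trans (cong (∑ ys (h x) +_) (∑-comm xs ys h))
                             (sym (∑-distrib-+ ys (h x) (λ y → ∑[ x ← xs ] h x y)))

∑-map : ∀ (xs : List A) (f : A → B) (h : B → ℕ) → ∑ (map f xs) h ≡ ∑[ x ← xs ] h (f x)
∑-map []       f h = refl
∑-map (x ∷ xs) f h = cong (h (f x) +_) (∑-map xs f h)

∑-++ : ∀ (xs ys : List A) (h : A → ℕ) → ∑ (xs ++ ys) h ≡ ∑ xs h + ∑ ys h
∑-++ xs ys h = trans (cong sum (map-++ h xs ys)) (sum-++ (map h xs) (map h ys))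

∑-concatMap : ∀ (xs : List A) (f : A → List B) (h : B → ℕ) →
              ∑ (concatMap f xs) h ≡ ∑[ x ← xs ] ∑ (f x) h
∑-concatMap []       f h = refl
∑-concatMap (x ∷ xs) f h =
  trans (∑-++ (f x) (concat (map f xs)) h) (cong (∑ (f x) h +_) (∑-concatMap xs f h))

∑-filterᵇ : ∀ (xs : List A) (p : A → Bool) (h : A → ℕ) →
            ∑ (filterᵇ p xs) h ≡ ∑[ x ← xs ] (𝟙 (p x) * h x)
∑-filterᵇ []       p h = refl
∑-filterᵇ (x ∷ xs) p h with p x
... | true  = cong₂ _+_ (sym (+-identityʳ (h x))) (∑-filterᵇ xs p h)
... | false = ∑-filterᵇ xs p h

∑-comm₃ : ∀ {c} {C : Set c} (xs : List A) (ys : List B) (zs : List C) (h : B → C → A → ℕ) →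
          ∑[ x ← xs ] ∑[ y ← ys ] ∑[ z ← zs ] h y z x ≡ ∑[ y ← ys ] ∑[ z ← zs ] ∑[ x ← xs ] h y z x
∑-comm₃ xs ys zs h = trans (∑-comm xs ys _) (∑-cong ys (λ y → ∑-comm xs zs (λ x z → h y z x)))

∑-downFrom-mono-≤ : ∀ N {g h : ℕ → ℕ} → (∀ {j} → j < N → g j ≤ h j) →
                    ∑ (downFrom N) g ≤ ∑ (downFrom N) h
∑-downFrom-mono-≤ zero    g≤h = z≤n
∑-downFrom-mono-≤ (suc N) g≤h = +-mono-≤ (g≤h ≤-refl) (∑-downFrom-mono-≤ N (g≤h ∘ m≤n⇒m≤1+n))

∑-downFrom-𝟙< : ∀ N s → ∑[ j ← downFrom N ] 𝟙 ⌊ j <? s ⌋ ≡ N ⊓ s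
∑-downFrom-𝟙< zero    s = refl
∑-downFrom-𝟙< (suc N) s with N <? s
... | yes N<s = begin
  suc (∑[ j ← downFrom N ] 𝟙 ⌊ j <? s ⌋) ≡⟨ cong suc (∑-downFrom-𝟙< N s) ⟩
  suc (N ⊓ s)                            ≡⟨ cong suc (m≤n⇒m⊓n≡m (<⇒≤ N<s)) ⟩
  suc N                                  ≡⟨ m≤n⇒m⊓n≡m N<s ⟨
  suc N ⊓ s                              ∎
  where open ≡-Reasoning
... | no  N≮s = begin
  ∑[ j ← downFrom N ] 𝟙 ⌊ j <? s ⌋       ≡⟨ ∑-downFrom-𝟙< N s ⟩
  N ⊓ s                                  ≡⟨ m≥n⇒m⊓n≡n (≮⇒≥ N≮s) ⟩
  s                                      ≡⟨ m≥n⇒m⊓n≡n (m≤n⇒m≤1+n (≮⇒≥ N≮s)) ⟨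
  suc N ⊓ s                              ∎
  where open ≡-Reasoning

∑-filterᵇ-mono-≤ : ∀ (xs : List A) (p : A → Bool) {g h : A → ℕ} → (∀ x → T (p x) → g x ≤ h x) →
                   ∑ (filterᵇ p xs) g ≤ ∑ (filterᵇ p xs) h
∑-filterᵇ-mono-≤ []       p g≤h = z≤n
∑-filterᵇ-mono-≤ (x ∷ xs) p g≤h with p x in px
... | true  = +-mono-≤ (g≤h x (subst T (sym px) tt)) (∑-filterᵇ-mono-≤ xs p g≤h)
... | false = ∑-filterᵇ-mono-≤ xs p g≤h

length≡∑1 : ∀ (xs : List A) → length xs ≡ ∑[ x ← xs ] 1
length≡∑1 []       = refl
length≡∑1 (x ∷ xs) = cong suc (length≡∑1 xs)

length-filterᵇ≡∑𝟙 : ∀ (xs : List A) (p : A → Bool) → length (filterᵇ p xs) ≡ ∑[ x ← xs ] 𝟙 (p x)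
length-filterᵇ≡∑𝟙 xs p = begin
  length (filterᵇ p xs)          ≡⟨ length≡∑1 (filterᵇ p xs) ⟩
  ∑[ x ← filterᵇ p xs ] 1        ≡⟨ ∑-filterᵇ xs p (λ _ → 1) ⟩
  ∑[ x ← xs ] (𝟙 (p x) * 1)      ≡⟨ ∑-cong xs (λ x → *-identityʳ (𝟙 (p x))) ⟩
  ∑[ x ← xs ] 𝟙 (p x)            ∎
  where open ≡-Reasoning

∑-≥-term : ∀ {x : A} {xs} (h : A → ℕ) → x ∈ xs → h x ≤ ∑ xs h
∑-≥-term h (here refl)          = m≤m+n _ _
∑-≥-term {xs = y ∷ _} h (there x∈xs) = ≤-trans (∑-≥-term h x∈xs) (m≤n+m _ (h y))

all-upTo⁻ : ∀ (p : ℕ → Bool) {k i} → T (all p (upTo k)) → i < k → T (p i)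
all-upTo⁻ p {k} all-p = applyUpTo⁻ id k (all⁺ p (upTo k) all-p)

all-upTo⁺ : ∀ (p : ℕ → Bool) {k} → (∀ {i} → i < k → T (p i)) → T (all p (upTo k))
all-upTo⁺ p {k} p<k = all⁻ p (applyUpTo⁺₁ id k p<k)

any⁺-∈ : ∀ (p : A → Bool) {x xs} → x ∈ xs → T (p x) → T (any p xs)
any⁺-∈ p x∈xs px = any⁺ p (lose x∈xs px)

map-upTo-cong : ∀ {k} {g h : ℕ → A} → (∀ {i} → i < k → g i ≡ h i) → map g (upTo k) ≡ map h (upTo k)
map-upTo-cong {k = k} g≗h = map-cong-local (applyUpTo⁺₁ id k g≗h)

module _ {A : Set a} (_≟ᴬ_ : DecidableEquality A) where

  multiplicity : A → List A → ℕ
  multiplicity x xs = ∑[ y ← xs ] 𝟙 ⌊ y ≟ᴬ x ⌋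

  Enumerates : List A → Set a
  Enumerates xs = ∀ x → multiplicity x xs ≡ 1

  ∑-select : ∀ (xs : List A) x (h : A → ℕ) →
             ∑[ y ← xs ] (𝟙 ⌊ y ≟ᴬ x ⌋ * h y) ≡ multiplicity x xs * h x
  ∑-select xs x h = trans (∑-cong xs select) (∑-*ʳ xs (h x) (λ y → 𝟙 ⌊ y ≟ᴬ x ⌋))
    where
    select : ∀ y → 𝟙 ⌊ y ≟ᴬ x ⌋ * h y ≡ 𝟙 ⌊ y ≟ᴬ x ⌋ * h x
    select y with y ≟ᴬ x
    ... | yes refl = refl
    ... | no  _    = refl

  ∑-reindex-involution : ∀ xs → Enumerates xs → (Φ : A → A) → (∀ x → Φ (Φ x) ≡ x) →
                         ∀ (h : A → ℕ) → ∑[ x ← xs ] h (Φ x) ≡ ∑ xs h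
  ∑-reindex-involution xs once Φ Φ∘Φ≗id h = begin
    ∑[ x ← xs ] h (Φ x)
      ≡⟨ ∑-cong xs (λ x → sym (expand (Φ x))) ⟩
    ∑[ x ← xs ] ∑[ y ← xs ] (𝟙 ⌊ y ≟ᴬ Φ x ⌋ * h y)
      ≡⟨ ∑-comm xs xs _ ⟩
    ∑[ y ← xs ] ∑[ x ← xs ] (𝟙 ⌊ y ≟ᴬ Φ x ⌋ * h y)
      ≡⟨ ∑-cong xs (λ y → ∑-cong xs (λ x → cong (_* h y) (flip y x))) ⟩
    ∑[ y ← xs ] ∑[ x ← xs ] (𝟙 ⌊ x ≟ᴬ Φ y ⌋ * h y)
      ≡⟨ ∑-cong xs (λ y → ∑-*ʳ xs (h y) (λ x → 𝟙 ⌊ x ≟ᴬ Φ y ⌋)) ⟩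
    ∑[ y ← xs ] (multiplicity (Φ y) xs * h y)
      ≡⟨ ∑-cong xs (λ y → trans (cong (_* h y) (once (Φ y))) (*-identityˡ (h y))) ⟩
    ∑ xs h ∎
    where
    open ≡-Reasoning
    expand : ∀ x → ∑[ y ← xs ] (𝟙 ⌊ y ≟ᴬ x ⌋ * h y) ≡ h x
    expand x = trans (∑-select xs x h) (trans (cong (_* h x) (once x)) (*-identityˡ (h x)))
    flip : ∀ y x → 𝟙 ⌊ y ≟ᴬ Φ x ⌋ ≡ 𝟙 ⌊ x ≟ᴬ Φ y ⌋
    flip y x = 𝟙-dec-cong (λ y≡Φx → trans (sym (Φ∘Φ≗id x)) (cong Φ (sym y≡Φx)))
                          (λ x≡Φy → trans (sym (Φ∘Φ≗id y)) (cong Φ (sym x≡Φy)))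

∑-filterᵇ-reindex-involution : ∀ (_≟ᴬ_ : DecidableEquality A) xs → Enumerates _≟ᴬ_ xs → (p : A → Bool) →
  (Φ : A → A) → (∀ x → Φ (Φ x) ≡ x) → (∀ x → p (Φ x) ≡ p x) →
  ∀ (h : A → ℕ) → ∑[ x ← filterᵇ p xs ] h (Φ x) ≡ ∑ (filterᵇ p xs) h
∑-filterᵇ-reindex-involution _≟ᴬ_ xs once p Φ Φ∘Φ≗id p∘Φ≗p h = begin
  ∑[ x ← filterᵇ p xs ] h (Φ x)
    ≡⟨ ∑-filterᵇ xs p _ ⟩
  ∑[ x ← xs ] (𝟙 (p x) * h (Φ x))
    ≡⟨ ∑-cong xs (λ x → cong (λ b → 𝟙 b * h (Φ x)) (sym (p∘Φ≗p x))) ⟩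
  ∑[ x ← xs ] (𝟙 (p (Φ x)) * h (Φ x))
    ≡⟨ ∑-reindex-involution _≟ᴬ_ xs once Φ Φ∘Φ≗id (λ x → 𝟙 (p x) * h x) ⟩
  ∑[ x ← xs ] (𝟙 (p x) * h x)
    ≡⟨ ∑-filterᵇ xs p h ⟨
  ∑ (filterᵇ p xs) h ∎
  where open ≡-Reasoning

allFin-enumerates : ∀ n → Enumerates _≟_ (allFin n)
allFin-enumerates (suc n) x = trans (cong (multiplicity _≟_ x) allFin-suc) (count x)
  where
  allFin-suc : allFin (suc n) ≡ Fin.zero ∷ map Fin.suc (allFin n)
  allFin-suc = cong (Fin.zero ∷_) (sym (map-tabulate id Fin.suc))
  count : ∀ x → multiplicity _≟_ x (Fin.zero ∷ map Fin.suc (allFin n)) ≡ 1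
  count Fin.zero    = cong suc (trans (∑-map (allFin n) Fin.suc _) (∑-zero (allFin n)))
  count (Fin.suc x) = trans (∑-map (allFin n) Fin.suc _)
    (trans (∑-cong (allFin n) (λ y → 𝟙-dec-cong suc-injective (cong Fin.suc))) (allFin-enumerates n x))

allVecs-enumerates : ∀ n k → Enumerates (≡-dec _≟_) (allVecs {n} k)
allVecs-enumerates n zero    Vec.[] = refl
allVecs-enumerates n (suc k) (x ∷ xs) = begin
  ∑[ ys ← allVecs {n} (suc k) ] 𝟙 ⌊ ys ≟ⱽ (x ∷ xs) ⌋
    ≡⟨ ∑-concatMap (allFin n) _ _ ⟩
  ∑[ y ← allFin n ] ∑[ ys ← map (y ∷_) (allVecs k) ] 𝟙 ⌊ ys ≟ⱽ (x ∷ xs) ⌋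
    ≡⟨ ∑-cong (allFin n) (λ y → ∑-map (allVecs k) (y ∷_) _) ⟩
  ∑[ y ← allFin n ] ∑[ ys ← allVecs k ] 𝟙 ⌊ (y ∷ ys) ≟ⱽ (x ∷ xs) ⌋
    ≡⟨ ∑-cong (allFin n) (λ y → ∑-cong (allVecs k) (𝟙-∷ y)) ⟩
  ∑[ y ← allFin n ] ∑[ ys ← allVecs k ] (𝟙 ⌊ y ≟ x ⌋ * 𝟙 ⌊ ys ≟ⱽ xs ⌋)
    ≡⟨ ∑-cong (allFin n) (λ y → ∑-*ˡ (allVecs k) (𝟙 ⌊ y ≟ x ⌋) _) ⟩
  ∑[ y ← allFin n ] (𝟙 ⌊ y ≟ x ⌋ * multiplicity _≟ⱽ_ xs (allVecs k))
    ≡⟨ ∑-cong (allFin n) (λ y → trans (cong (𝟙 ⌊ y ≟ x ⌋ *_) (allVecs-enumerates n k xs)) (*-identityʳ _)) ⟩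
  multiplicity _≟_ x (allFin n)
    ≡⟨ allFin-enumerates n x ⟩
  1 ∎
  where
  open ≡-Reasoning
  _≟ⱽ_ : ∀ {k} → DecidableEquality (Vec (Fin n) k)
  _≟ⱽ_ = ≡-dec _≟_
  𝟙-∷ : ∀ y (ys : Vec (Fin n) k) →
        𝟙 ⌊ (y ∷ ys) ≟ⱽ (x ∷ xs) ⌋ ≡ 𝟙 ⌊ y ≟ x ⌋ * 𝟙 ⌊ ys ≟ⱽ xs ⌋
  𝟙-∷ y ys = trans (𝟙-dec-cong ∷-injective (uncurry (cong₂ _∷_))) (𝟙-×-dec (y ≟ x) (ys ≟ⱽ xs))

multiplicity-downFrom-≤ : ∀ {N t} → N ≤ t → multiplicity ℕ._≟_ t (downFrom N) ≡ 0
multiplicity-downFrom-≤ {zero}  _     = refl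
multiplicity-downFrom-≤ {suc N} {t} N<t with N ℕ.≟ t
... | yes refl = ⊥-elim (<-irrefl refl N<t)
... | no  _    = multiplicity-downFrom-≤ (<⇒≤ N<t)

multiplicity-downFrom-< : ∀ {N t} → t < N → multiplicity ℕ._≟_ t (downFrom N) ≡ 1
multiplicity-downFrom-< {suc N} {t} t<1+N with N ℕ.≟ t
... | yes refl = cong suc (multiplicity-downFrom-≤ {N} ≤-refl)
... | no  N≢t  = multiplicity-downFrom-< (≤∧≢⇒< (≤-pred t<1+N) (≢-sym N≢t))

_∉ᵇ_ : ∀ {n} → Fin n → List (Fin n) → Bool
w ∉ᵇ xs = not (any (λ x → ⌊ w ≟ x ⌋) xs)

∉ᵇ⇒≢ : ∀ {n} {w x : Fin n} {xs} → T (w ∉ᵇ xs) → x ∈ xs → w ≢ x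
∉ᵇ⇒≢ w∉xs x∈xs w≡x = T-not⇒¬T w∉xs (any⁺-∈ _ x∈xs (fromWitness w≡x))

n≤∑∉ᵇ+length : ∀ {n} (xs : List (Fin n)) → n ≤ ∑[ w ← allFin n ] 𝟙 (w ∉ᵇ xs) + length xs
n≤∑∉ᵇ+length {n} [] = ≤-reflexive (begin
  n                          ≡⟨ length-tabulate id ⟨
  length (allFin n)          ≡⟨ length≡∑1 (allFin n) ⟩
  ∑[ w ← allFin n ] 1        ≡⟨ +-identityʳ _ ⟨
  ∑[ w ← allFin n ] 1 + 0    ∎)
  where open ≡-Reasoning
n≤∑∉ᵇ+length {n} (x ∷ xs) = begin
  n
    ≤⟨ n≤∑∉ᵇ+length xs ⟩
  ∑[ w ← allFin n ] 𝟙 (w ∉ᵇ xs) + length xs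
    ≤⟨ +-monoˡ-≤ (length xs) (∑-mono-≤ (allFin n) ∉ᵇ-∷) ⟩
  ∑[ w ← allFin n ] (𝟙 (w ∉ᵇ (x ∷ xs)) + 𝟙 ⌊ w ≟ x ⌋) + length xs
    ≡⟨ cong (_+ length xs) (∑-distrib-+ (allFin n) _ _) ⟩
  outside + multiplicity _≟_ x (allFin n) + length xs
    ≡⟨ cong (λ m → outside + m + length xs) (allFin-enumerates n x) ⟩
  outside + 1 + length xs
    ≡⟨ +-assoc outside 1 (length xs) ⟩
  outside + length (x ∷ xs) ∎
  where
  open ≤-Reasoning
  outside = ∑[ w ← allFin n ] 𝟙 (w ∉ᵇ (x ∷ xs))
  ∉ᵇ-∷ : ∀ w → 𝟙 (w ∉ᵇ xs) ≤ 𝟙 (w ∉ᵇ (x ∷ xs)) + 𝟙 ⌊ w ≟ x ⌋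
  ∉ᵇ-∷ w with w ≟ x
  ... | yes _ = 𝟙≤1 (w ∉ᵇ xs)
  ... | no  _ = ≤-reflexive (sym (+-identityʳ _))

module _ {n : ℕ} where

  transpose-matchˡ : ∀ (i j : Fin n) → transpose i j i ≡ j
  transpose-matchˡ i j rewrite dec-true (i ≟ i) refl = refl

  transpose-matchʳ : ∀ (i j : Fin n) → transpose i j j ≡ i
  transpose-matchʳ i j with j ≟ i
  ... | yes refl = refl
  ... | no _ rewrite dec-true (j ≟ j) refl = refl

  transpose-other : ∀ {i j k : Fin n} → k ≢ i → k ≢ j → transpose i j k ≡ k
  transpose-other {i} {j} {k} k≢i k≢j rewrite dec-false (k ≟ i) k≢i | dec-false (k ≟ j) k≢j = refl

  transpose-involutive : ∀ (i j k : Fin n) → transpose i j (transpose i j k) ≡ k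
  transpose-involutive i j k = by-cases (k ≟ i) (k ≟ j)
    where
    by-cases : Dec (k ≡ i) → Dec (k ≡ j) → transpose i j (transpose i j k) ≡ k
    by-cases (yes k≡i) _ rewrite k≡i =
      trans (cong (transpose i j) (transpose-matchˡ i j)) (transpose-matchʳ i j)
    by-cases (no _) (yes k≡j) rewrite k≡j =
      trans (cong (transpose i j) (transpose-matchʳ i j)) (transpose-matchˡ i j)
    by-cases (no k≢i) (no k≢j) =
      trans (cong (transpose i j) (transpose-other k≢i k≢j)) (transpose-other k≢i k≢j)

_∘ᵐ_ : ∀ {n} → Map n → (Fin n → Fin n) → Map n
f ∘ᵐ π = Vec.tabulate (app f ∘ π)

fiberSize≡∑𝟙 : ∀ {n} (f : Map n) i → fiberSize f i ≡ ∑[ j ← allFin n ] 𝟙 ⌊ app f j ≟ i ⌋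
fiberSize≡∑𝟙 {n} f i = length-filterᵇ≡∑𝟙 (allFin n) (λ j → ⌊ app f j ≟ i ⌋)

module _ {n : ℕ} (π : Fin n → Fin n) (π-involutive : ∀ i → π (π i) ≡ i) where

  app-∘ᵐ : ∀ (f : Map n) i → app (f ∘ᵐ π) i ≡ app f (π i)
  app-∘ᵐ f i = lookup∘tabulate (app f ∘ π) i

  ∘ᵐ-involutive : ∀ (f : Map n) → (f ∘ᵐ π) ∘ᵐ π ≡ f
  ∘ᵐ-involutive f = trans (tabulate-cong (λ i → trans (app-∘ᵐ f (π i)) (cong (app f) (π-involutive i))))
                          (tabulate∘lookup f)

  fiberSize-∘ᵐ : ∀ (f : Map n) i → fiberSize (f ∘ᵐ π) i ≡ fiberSize f i
  fiberSize-∘ᵐ f i = begin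
    fiberSize (f ∘ᵐ π) i
      ≡⟨ fiberSize≡∑𝟙 (f ∘ᵐ π) i ⟩
    ∑[ j ← allFin n ] 𝟙 ⌊ app (f ∘ᵐ π) j ≟ i ⌋
      ≡⟨ ∑-cong (allFin n) (λ j → cong (λ y → 𝟙 ⌊ y ≟ i ⌋) (app-∘ᵐ f j)) ⟩
    ∑[ j ← allFin n ] 𝟙 ⌊ app f (π j) ≟ i ⌋
      ≡⟨ ∑-reindex-involution _≟_ (allFin n) (allFin-enumerates n) π π-involutive (λ j → 𝟙 ⌊ app f j ≟ i ⌋) ⟩
    ∑[ j ← allFin n ] 𝟙 ⌊ app f j ≟ i ⌋
      ≡⟨ fiberSize≡∑𝟙 f i ⟨
    fiberSize f i ∎
    where open ≡-Reasoning

  hasDegrees-∘ᵐ : ∀ (d : Fin n → ℕ) (f : Map n) → hasDegrees d (f ∘ᵐ π) ≡ hasDegrees d f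
  hasDegrees-∘ᵐ d f = cong and (map-cong (λ i → cong (_≡ᵇ d i) (fiberSize-∘ᵐ f i)) (allFin n))

module _ {n : ℕ} (f : Map n) (v : Fin n) where

  searchSix-≥ : ∀ k fuel → k ≤ searchSix f v k fuel
  searchSix-≥ k zero       = ≤-refl
  searchSix-≥ k (suc fuel) with seenBefore f v k
  ... | true  = ≤-refl
  ... | false = ≤-trans (n≤1+n k) (searchSix-≥ (suc k) fuel)

  searchSix-≤ : ∀ k fuel → searchSix f v k fuel ≤ k + fuel
  searchSix-≤ k zero       = ≤-reflexive (sym (+-identityʳ k))
  searchSix-≤ k (suc fuel) with seenBefore f v k
  ... | true  = m≤m+n k (suc fuel)
  ... | false = ≤-trans (searchSix-≤ (suc k) fuel) (≤-reflexive (sym (+-suc k fuel)))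

  searchSix-unseen : ∀ k fuel {i} → k ≤ i → i < searchSix f v k fuel → ¬ T (seenBefore f v i)
  searchSix-unseen k zero       k≤i i<k = ⊥-elim (<-irrefl refl (≤-trans i<k k≤i))
  searchSix-unseen k (suc fuel) k≤i i<s with seenBefore f v k in seen
  ... | true  = ⊥-elim (<-irrefl refl (≤-trans i<s k≤i))
  ... | false with m≤n⇒m<n∨m≡n k≤i
  ...   | inj₁ k<i  = searchSix-unseen (suc k) fuel k<i i<s
  ...   | inj₂ refl = subst T seen

  ≤-searchSix : ∀ k fuel {J} → (∀ {i} → k ≤ i → i < J → ¬ T (seenBefore f v i)) → J ≤ k + fuel →
                J ≤ searchSix f v k fuel
  ≤-searchSix k zero       _      J≤k+0 = ≤-trans J≤k+0 (≤-reflexive (+-identityʳ k))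
  ≤-searchSix k (suc fuel) {J} unseen J≤ with seenBefore f v k in seen
  ... | false = ≤-searchSix (suc k) fuel (λ k<i → unseen (<⇒≤ k<i)) (≤-trans J≤ (≤-reflexive (+-suc k fuel)))
  ... | true with J ≤? k
  ...   | yes J≤k = J≤k
  ...   | no  J≰k = ⊥-elim (unseen ≤-refl (≰⇒> J≰k) (subst T (sym seen) tt))

  six-pos : 0 < six f v
  six-pos = searchSix-≥ 1 (suc n)

  six≤2+n : six f v ≤ 2 + n
  six≤2+n = searchSix-≤ 1 (suc n)

  unseen-below-six : ∀ {i} → i < six f v → ¬ T (seenBefore f v i)
  unseen-below-six {zero}  _     ()
  unseen-below-six {suc i} i<six = searchSix-unseen 1 (suc n) (s≤s z≤n) i<six

  ≤-six : ∀ {J} → (∀ {i} → i < J → ¬ T (seenBefore f v i)) → J ≤ 2 + n → J ≤ six f v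
  ≤-six unseen = ≤-searchSix 1 (suc n) (λ _ → unseen)

  searchTail-≥ : ∀ s j fuel → j ≤ searchTail f v s j fuel
  searchTail-≥ s j zero       = ≤-refl
  searchTail-≥ s j (suc fuel) with ⌊ iter f j v ≟ iter f s v ⌋
  ... | true  = ≤-refl
  ... | false = ≤-trans (n≤1+n j) (searchTail-≥ s (suc j) fuel)

  tailLen≡0⇒periodic : tailLen f v ≡ 0 → iter f (six f v) v ≡ v
  tailLen≡0⇒periodic = returns (six f v) six-pos
    where
    returns : ∀ s → 0 < s → searchTail f v s 0 s ≡ 0 → iter f s v ≡ v
    returns (suc s) _ search≡0 with v ≟ iter f (suc s) v
    ... | yes v≡fˢv = sym v≡fˢv
    ... | no  _     = ⊥-elim (<-irrefl (sym search≡0) (searchTail-≥ (suc s) 1 s))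

onCycle : ∀ {n} → Map n → Fin n → Bool
onCycle f v = tailLen f v ≡ᵇ 0

module Switching {n : ℕ} (v : Fin n) where

  orbit : Map n → ℕ → List (Fin n)
  orbit f j = map (λ i → iter f i v) (upTo (suc j))

  distinctUpTo : Map n → ℕ → Bool
  distinctUpTo f j = all (not ∘ seenBefore f v) (upTo (suc j))

  switchable : ℕ → Fin n → Map n → Bool
  switchable j w f = distinctUpTo f j ∧ (w ∉ᵇ orbit f j)

  switch : ℕ → Fin n → Map n → Map n
  switch j w f = if switchable j w f then f ∘ᵐ transpose w (iter f j v) else f

  module _ (j : ℕ) (w : Fin n) (f : Map n) where

    switch-switchable : T (switchable j w f) → switch j w f ≡ f ∘ᵐ transpose w (iter f j v)
    switch-switchable s with switchable j w f
    ... | true = refl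

    switch-unswitchable : ¬ T (switchable j w f) → switch j w f ≡ f
    switch-unswitchable ¬s with switchable j w f
    ... | true  = ⊥-elim (¬s tt)
    ... | false = refl

    switchable⇒avoids : T (switchable j w f) → ∀ {i} → i ≤ j → w ≢ iter f i v
    switchable⇒avoids s i≤j =
      ∉ᵇ⇒≢ (proj₂ (T-∧-elim (distinctUpTo f j) s)) (∈-map⁺ (λ i → iter f i v) (∈-upTo⁺ (s≤s i≤j)))

    switchable⇒distinct : T (switchable j w f) → ∀ {i′ i} → i′ < i → i ≤ j → iter f i′ v ≢ iter f i v
    switchable⇒distinct s {i′} {i} i′<i i≤j fⁱ′v≡fⁱv =
      T-not⇒¬T (all-upTo⁻ (not ∘ seenBefore f v) (proj₁ (T-∧-elim (distinctUpTo f j) s)) (s≤s i≤j))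
               (any⁺-∈ _ (∈-upTo⁺ i′<i) (fromWitness fⁱ′v≡fⁱv))

    iter-switch : T (switchable j w f) → ∀ {i} → i ≤ j → iter (switch j w f) i v ≡ iter f i v
    iter-switch s {zero}  _      = refl
    iter-switch s {suc i} i+1≤j = begin
      app (switch j w f) (iter (switch j w f) i v)
        ≡⟨ cong₂ app (switch-switchable s) (iter-switch s (<⇒≤ i+1≤j)) ⟩
      app (f ∘ᵐ τ) (iter f i v)
        ≡⟨ app-∘ᵐ τ (transpose-involutive w (iter f j v)) f (iter f i v) ⟩
      app f (τ (iter f i v))
        ≡⟨ cong (app f) (transpose-other fⁱv≢w (switchable⇒distinct s i+1≤j ≤-refl)) ⟩
      app f (iter f i v) ∎
      where
      open ≡-Reasoning
      τ = transpose w (iter f j v)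
      fⁱv≢w = ≢-sym (switchable⇒avoids s (<⇒≤ i+1≤j))

  switchable-cong : ∀ {j w} {f g : Map n} → (∀ {i} → i ≤ j → iter g i v ≡ iter f i v) →
                    switchable j w g ≡ switchable j w f
  switchable-cong {j} {w} {f} {g} g≈f = cong₂ (λ distinct orb → distinct ∧ (w ∉ᵇ orb))
    (cong and (map-upTo-cong (cong not ∘ seen-cong)))
    (map-upTo-cong (λ i<j+1 → g≈f (≤-pred i<j+1)))
    where
    seen-cong : ∀ {i} → i < suc j → seenBefore g v i ≡ seenBefore f v i
    seen-cong {i} i≤j = cong or (map-upTo-cong (λ i′<i →
      cong₂ (λ x y → ⌊ x ≟ y ⌋) (g≈f (≤-trans (<⇒≤ i′<i) (≤-pred i≤j))) (g≈f (≤-pred i≤j))))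

  switch-involutive : ∀ j w (f : Map n) → switch j w (switch j w f) ≡ f
  switch-involutive j w f with T? (switchable j w f)
  ... | no ¬s = trans (cong (switch j w) (switch-unswitchable j w f ¬s)) (switch-unswitchable j w f ¬s)
  ... | yes s = begin
    switch j w g
      ≡⟨ switch-switchable j w g g-switchable ⟩
    g ∘ᵐ transpose w (iter g j v)
      ≡⟨ cong₂ (λ h x → h ∘ᵐ transpose w x) (switch-switchable j w f s) (iter-switch j w f s ≤-refl) ⟩
    (f ∘ᵐ τ) ∘ᵐ τ
      ≡⟨ ∘ᵐ-involutive τ (transpose-involutive w (iter f j v)) f ⟩
    f ∎
    where
    open ≡-Reasoning
    g = switch j w f
    τ = transpose w (iter f j v)
    g-switchable : T (switchable j w g)
    g-switchable = subst T (sym (switchable-cong {j} {w} (iter-switch j w f s))) s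

  hasDegrees-switch : ∀ (d : Fin n → ℕ) j w (f : Map n) → hasDegrees d (switch j w f) ≡ hasDegrees d f
  hasDegrees-switch d j w f with T? (switchable j w f)
  ... | no ¬s = cong (hasDegrees d) (switch-unswitchable j w f ¬s)
  ... | yes s = trans (cong (hasDegrees d) (switch-switchable j w f s))
                      (hasDegrees-∘ᵐ _ (transpose-involutive w (iter f j v)) d f)

module Counting {n : ℕ} (v : Fin n) where
  open Switching v

  -- j ranges over downFrom N, which contains every cycle length minus one since six≤2+n.
  N : ℕ
  N = 2 + n

  P : ℕ → Fin n → Map n → ℕ
  P j w f = 𝟙 (⌊ j ℕ.≟ pred (six f v) ⌋ ∧ onCycle f v ∧ w ∉ᵇ orbit f j)

  Q : ℕ → Fin n → Map n → ℕ
  Q j w g = 𝟙 (⌊ app g w ≟ v ⌋ ∧ switchable j w g)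

  ∑P : Map n → ℕ
  ∑P f = ∑[ j ← downFrom N ] ∑[ w ← allFin n ] P j w f

  ∑Q : Map n → ℕ
  ∑Q g = ∑[ j ← downFrom N ] ∑[ w ← allFin n ] Q j w g

  suc-pred-six : ∀ f → suc (pred (six f v)) ≡ six f v
  suc-pred-six f = suc-pred (six f v) {{ℕ.>-nonZero (six-pos f v)}}

  onCycle⇒closes : ∀ {f} → T (onCycle f v) → app f (iter f (pred (six f v)) v) ≡ v
  onCycle⇒closes {f} cyc = trans (cong (λ k → iter f k v) (suc-pred-six f))
                                 (tailLen≡0⇒periodic f v (≡ᵇ⇒≡ (tailLen f v) 0 cyc))

  distinct-below-six : ∀ {f j} → j ≡ pred (six f v) → T (distinctUpTo f j)
  distinct-below-six {f} refl = all-upTo⁺ _ (λ i<s → ¬T⇒T-not (unseen-below-six f v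
    (≤-trans i<s (≤-reflexive (suc-pred-six f)))))

  switchable⇒<six : ∀ {j w g} → j < N → T (switchable j w g) → j < six g v
  switchable⇒<six {j} {w} {g} j<N s = ≤-six g v
    (T-not⇒¬T ∘ all-upTo⁻ (not ∘ seenBefore g v) (proj₁ (T-∧-elim (distinctUpTo g j) s))) j<N

  P≤Q∘switch : ∀ j w f → P j w f ≤ Q j w (switch j w f)
  P≤Q∘switch j w f = 𝟙-mono λ p →
    let j≡ , rest = T-∧-elim ⌊ j ℕ.≟ pred (six f v) ⌋ p
        cyc , w∉ = T-∧-elim (onCycle f v) rest
        s = T-∧-intro (distinctUpTo f j) (distinct-below-six (toWitness j≡)) w∉
    in T-∧-intro ⌊ app (switch j w f) w ≟ v ⌋ (fromWitness (closes (toWitness j≡) cyc s))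
                 (subst T (sym (switchable-cong {j} {w} (iter-switch j w f s))) s)
    where
    τ = transpose w (iter f j v)
    closes : j ≡ pred (six f v) → T (onCycle f v) → T (switchable j w f) → app (switch j w f) w ≡ v
    closes j≡ cyc s = begin
      app (switch j w f) w  ≡⟨ cong (λ g → app g w) (switch-switchable j w f s) ⟩
      app (f ∘ᵐ τ) w        ≡⟨ app-∘ᵐ τ (transpose-involutive w (iter f j v)) f w ⟩
      app f (τ w)           ≡⟨ cong (app f) (transpose-matchˡ w (iter f j v)) ⟩
      app f (iter f j v)    ≡⟨ subst (λ k → app f (iter f k v) ≡ v) (sym j≡) (onCycle⇒closes cyc) ⟩
      v                     ∎
      where open ≡-Reasoning

  Q≤hit*below-six : ∀ {j} w g → j < N → Q j w g ≤ 𝟙 ⌊ app g w ≟ v ⌋ * 𝟙 ⌊ j <? six g v ⌋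
  Q≤hit*below-six w g j<N = ≤-trans
    (𝟙-mono λ q → let hit , s = T-∧-elim ⌊ app g w ≟ v ⌋ q in
                  T-∧-intro ⌊ app g w ≟ v ⌋ hit (fromWitness (switchable⇒<six j<N s)))
    (≤-reflexive (𝟙-∧ ⌊ app g w ≟ v ⌋ ⌊ _ <? six g v ⌋))

  ∑Q≤six*fiberSize : ∀ g → ∑Q g ≤ six g v * fiberSize g v
  ∑Q≤six*fiberSize g = begin
    ∑Q g
      ≤⟨ ∑-downFrom-mono-≤ N (λ j<N → ∑-mono-≤ (allFin n) (λ w → Q≤hit*below-six w g j<N)) ⟩
    ∑[ j ← downFrom N ] ∑[ w ← allFin n ] (𝟙 ⌊ app g w ≟ v ⌋ * 𝟙 ⌊ j <? six g v ⌋)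
      ≡⟨ ∑-cong (downFrom N) (λ j → trans (∑-*ʳ (allFin n) _ _) (cong (_* 𝟙 ⌊ j <? six g v ⌋) (sym (fiberSize≡∑𝟙 g v)))) ⟩
    ∑[ j ← downFrom N ] (fiberSize g v * 𝟙 ⌊ j <? six g v ⌋)
      ≡⟨ ∑-*ˡ (downFrom N) (fiberSize g v) _ ⟩
    fiberSize g v * ∑[ j ← downFrom N ] 𝟙 ⌊ j <? six g v ⌋
      ≡⟨ cong (fiberSize g v *_) (∑-downFrom-𝟙< N (six g v)) ⟩
    fiberSize g v * (N ⊓ six g v)
      ≤⟨ *-monoʳ-≤ (fiberSize g v) (m⊓n≤n N (six g v)) ⟩
    fiberSize g v * six g v
      ≡⟨ *-comm (fiberSize g v) (six g v) ⟩
    six g v * fiberSize g v ∎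
    where open ≤-Reasoning

  ∑P≡#off-orbit : ∀ f → T (onCycle f v) → ∑P f ≡ ∑[ w ← allFin n ] 𝟙 (w ∉ᵇ orbit f (pred (six f v)))
  ∑P≡#off-orbit f cyc = trans (∑-comm (downFrom N) (allFin n) (λ j w → P j w f)) (∑-cong (allFin n) select)
    where
    t = pred (six f v)
    t<N : t < N
    t<N = subst (_≤ N) (sym (suc-pred-six f)) (six≤2+n f v)
    select : ∀ w → ∑[ j ← downFrom N ] P j w f ≡ 𝟙 (w ∉ᵇ orbit f t)
    select w = begin
      ∑[ j ← downFrom N ] P j w f
        ≡⟨ ∑-cong (downFrom N) (λ j → 𝟙-∧ ⌊ j ℕ.≟ t ⌋ _) ⟩
      ∑[ j ← downFrom N ] (𝟙 ⌊ j ℕ.≟ t ⌋ * 𝟙 (onCycle f v ∧ w ∉ᵇ orbit f j))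
        ≡⟨ ∑-select ℕ._≟_ (downFrom N) t (λ j → 𝟙 (onCycle f v ∧ w ∉ᵇ orbit f j)) ⟩
      multiplicity ℕ._≟_ t (downFrom N) * 𝟙 (onCycle f v ∧ w ∉ᵇ orbit f t)
        ≡⟨ cong (_* 𝟙 (onCycle f v ∧ w ∉ᵇ orbit f t)) (multiplicity-downFrom-< t<N) ⟩
      1 * 𝟙 (onCycle f v ∧ w ∉ᵇ orbit f t)
        ≡⟨ trans (*-identityˡ _) (𝟙-∧-T (w ∉ᵇ orbit f t) cyc) ⟩
      𝟙 (w ∉ᵇ orbit f t) ∎
      where open ≡-Reasoning

  n≤∑P+six*fiberSize : ∀ f → 𝟙 (onCycle f v) * n ≤ ∑P f + six f v * fiberSize f v
  n≤∑P+six*fiberSize f = 𝟙*≤ (onCycle f v) λ cyc → begin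
    n
      ≤⟨ n≤∑∉ᵇ+length (orbit f t) ⟩
    ∑[ w ← allFin n ] 𝟙 (w ∉ᵇ orbit f t) + length (orbit f t)
      ≡⟨ cong₂ _+_ (sym (∑P≡#off-orbit f cyc)) length-orbit ⟩
    ∑P f + six f v
      ≤⟨ +-monoʳ-≤ (∑P f) (m≤m*n (six f v) (fiberSize f v) {{ℕ.>-nonZero (fiberSize-pos cyc)}}) ⟩
    ∑P f + six f v * fiberSize f v ∎
    where
    open ≤-Reasoning
    t = pred (six f v)
    length-orbit : length (orbit f t) ≡ six f v
    length-orbit = trans (length-map _ (upTo (suc t))) (trans (length-upTo (suc t)) (suc-pred-six f))
    fiberSize-pos : T (onCycle f v) → 0 < fiberSize f v
    fiberSize-pos cyc = begin
      1                                   ≡⟨ 𝟙-T (fromWitness (onCycle⇒closes cyc)) ⟨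
      𝟙 ⌊ app f (iter f t v) ≟ v ⌋        ≤⟨ ∑-≥-term (λ j → 𝟙 ⌊ app f j ≟ v ⌋) (∈-allFin (iter f t v)) ⟩
      ∑[ j ← allFin n ] 𝟙 ⌊ app f j ≟ v ⌋ ≡⟨ fiberSize≡∑𝟙 f v ⟨
      fiberSize f v                       ∎

  module _ (d : Fin n → ℕ) where

    fiberSize≡degree : ∀ {f} → T (hasDegrees d f) → fiberSize f v ≡ d v
    fiberSize≡degree {f} deg = ≡ᵇ⇒≡ (fiberSize f v) (d v) (All.lookup (all⁺ _ (allFin n) deg) (∈-allFin v))

    ∑-𝔉-switch : ∀ j w (h : Map n → ℕ) → ∑[ f ← 𝔉 d ] h (switch j w f) ≡ ∑ (𝔉 d) h
    ∑-𝔉-switch j w = ∑-filterᵇ-reindex-involution (≡-dec _≟_) (allVecs n) (allVecs-enumerates n n) (hasDegrees d)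
                       (switch j w) (switch-involutive j w) (hasDegrees-switch d j w)

    ∑P≤∑Q : ∑ (𝔉 d) ∑P ≤ ∑ (𝔉 d) ∑Q
    ∑P≤∑Q = begin
      ∑ (𝔉 d) ∑P
        ≡⟨ ∑-comm₃ (𝔉 d) (downFrom N) (allFin n) P ⟩
      ∑[ j ← downFrom N ] ∑[ w ← allFin n ] ∑[ f ← 𝔉 d ] P j w f
        ≤⟨ ∑-mono-≤ (downFrom N) (λ j → ∑-mono-≤ (allFin n) (λ w → ∑-mono-≤ (𝔉 d) (P≤Q∘switch j w))) ⟩
      ∑[ j ← downFrom N ] ∑[ w ← allFin n ] ∑[ f ← 𝔉 d ] Q j w (switch j w f)
        ≡⟨ ∑-cong (downFrom N) (λ j → ∑-cong (allFin n) (λ w → ∑-𝔉-switch j w (Q j w))) ⟩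
      ∑[ j ← downFrom N ] ∑[ w ← allFin n ] ∑[ f ← 𝔉 d ] Q j w f
        ≡⟨ ∑-comm₃ (𝔉 d) (downFrom N) (allFin n) Q ⟨
      ∑ (𝔉 d) ∑Q ∎
      where open ≤-Reasoning

    #onCycle*n≤2*d*∑six : length (filterᵇ (λ f → onCycle f v) (𝔉 d)) * n ≤ 2 * d v * ∑[ f ← 𝔉 d ] six f v
    #onCycle*n≤2*d*∑six = begin
      length (filterᵇ (λ f → onCycle f v) (𝔉 d)) * n
        ≡⟨ cong (_* n) (length-filterᵇ≡∑𝟙 (𝔉 d) (λ f → onCycle f v)) ⟩
      ∑[ f ← 𝔉 d ] 𝟙 (onCycle f v) * n
        ≡⟨ ∑-*ʳ (𝔉 d) n (λ f → 𝟙 (onCycle f v)) ⟨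
      ∑[ f ← 𝔉 d ] (𝟙 (onCycle f v) * n)
        ≤⟨ ∑-filterᵇ-mono-≤ (allVecs n) (hasDegrees d) (λ f deg →
             subst (λ k → 𝟙 (onCycle f v) * n ≤ ∑P f + six f v * k) (fiberSize≡degree {f} deg) (n≤∑P+six*fiberSize f)) ⟩
      ∑[ f ← 𝔉 d ] (∑P f + six f v * d v)
        ≡⟨ ∑-distrib-+ (𝔉 d) ∑P (λ f → six f v * d v) ⟩
      ∑ (𝔉 d) ∑P + X
        ≤⟨ +-monoˡ-≤ X ∑P≤∑Q ⟩
      ∑ (𝔉 d) ∑Q + X
        ≤⟨ +-monoˡ-≤ X (∑-filterᵇ-mono-≤ (allVecs n) (hasDegrees d) (λ g deg →
             subst (λ k → ∑Q g ≤ six g v * k) (fiberSize≡degree {g} deg) (∑Q≤six*fiberSize g))) ⟩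
      X + X
        ≡⟨ cong (X +_) (+-identityʳ X) ⟨
      2 * X
        ≡⟨ cong (2 *_) (trans (∑-*ʳ (𝔉 d) (d v) (λ f → six f v)) (*-comm S (d v))) ⟩
      2 * (d v * S)
        ≡⟨ *-assoc 2 (d v) S ⟨
      2 * d v * S ∎
      where
      open ≤-Reasoning
      S = ∑[ f ← 𝔉 d ] six f v
      X = ∑[ f ← 𝔉 d ] (six f v * d v)

frac-nonNeg : ∀ a b → ℚ.NonNegative (frac a b)
frac-nonNeg a zero    = _
frac-nonNeg a (suc b) = ℚ.normalize-nonNeg a (suc b)

ℕ/1-nonNeg : ∀ a → ℚ.NonNegative (ℤ.+ a ℚ./ 1)
ℕ/1-nonNeg a = ℚ.normalize-nonNeg a 1

≤-+-nonNeg : ∀ p q → .{{ℚ.NonNegative q}} → p ℚ.≤ p ℚ.+ q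
≤-+-nonNeg p q = subst (ℚ._≤ p ℚ.+ q) (ℚ.+-identityʳ p) (ℚ.+-monoʳ-≤ p (ℚ.nonNegative⁻¹ q))

-- Cross-multiplied in ℚᵘ, where frac a (suc b) is the unnormalised a / (1 + b).
frac-≤-scaled : ∀ a b c k l m → a * suc m ≤ k * l * c →
                frac a b ℚ.≤ (ℤ.+ k ℚ./ 1) ℚ.* ((ℤ.+ l ℚ./ 1) ℚ.* frac c (b * suc m))
frac-≤-scaled a zero c k l m _ = ℚ.nonNegative⁻¹ _
  {{ℚ.nonNeg*nonNeg⇒nonNeg (ℤ.+ k ℚ./ 1) {{ℕ/1-nonNeg k}} _
    {{ℚ.nonNeg*nonNeg⇒nonNeg (ℤ.+ l ℚ./ 1) {{ℕ/1-nonNeg l}} (frac c 0) {{frac-nonNeg c 0}}}}}}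
frac-≤-scaled a (suc b) c k l m a*m≤k*l*c = ℚ.toℚᵘ-cancel-≤
  (ℚᵘ.≤-respˡ-≃ (ℚᵘ.≃-sym (toℚᵘ-/ a b))
  (ℚᵘ.≤-respʳ-≃ (ℚᵘ.≃-sym rhs≃) (ℚᵘ.*≤* cross)))
  where
  toℚᵘ-/ : ∀ x y → ℚ.toℚᵘ (ℤ.+ x ℚ./ suc y) ℚᵘ.≃ ℚᵘ.mkℚᵘ (ℤ.+ x) y
  toℚᵘ-/ x y = ℚ.toℚᵘ-fromℚᵘ (ℚᵘ.mkℚᵘ (ℤ.+ x) y)
  rhs≃ : ℚ.toℚᵘ ((ℤ.+ k ℚ./ 1) ℚ.* ((ℤ.+ l ℚ./ 1) ℚ.* frac c (suc b * suc m)))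
         ℚᵘ.≃ ℚᵘ.mkℚᵘ (ℤ.+ k) 0 ℚᵘ.* (ℚᵘ.mkℚᵘ (ℤ.+ l) 0 ℚᵘ.* ℚᵘ.mkℚᵘ (ℤ.+ c) (pred (suc b * suc m)))
  rhs≃ = ℚᵘ.≃-trans (ℚ.toℚᵘ-homo-* (ℤ.+ k ℚ./ 1) _)
           (ℚᵘ.*-cong (toℚᵘ-/ k 0) (ℚᵘ.≃-trans (ℚ.toℚᵘ-homo-* (ℤ.+ l ℚ./ 1) _)
             (ℚᵘ.*-cong (toℚᵘ-/ l 0) (toℚᵘ-/ c (pred (suc b * suc m))))))
  cross-ℕ : a * (1 * (1 * (suc b * suc m))) ≤ k * (l * c) * suc b
  cross-ℕ = begin
    a * (1 * (1 * (suc b * suc m)))  ≡⟨ cong (a *_) (trans (*-identityˡ _) (*-identityˡ _)) ⟩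
    a * (suc b * suc m)              ≡⟨ cong (a *_) (*-comm (suc b) (suc m)) ⟩
    a * (suc m * suc b)              ≡⟨ *-assoc a (suc m) (suc b) ⟨
    a * suc m * suc b                ≤⟨ *-monoˡ-≤ (suc b) a*m≤k*l*c ⟩
    k * l * c * suc b                ≡⟨ cong (_* suc b) (*-assoc k l c) ⟩
    k * (l * c) * suc b              ∎
    where open ≤-Reasoning
  cross : ℤ.+ a ℤ.* ℤ.+ (1 * (1 * (suc b * suc m))) ℤ.≤ (ℤ.+ k ℤ.* (ℤ.+ l ℤ.* ℤ.+ c)) ℤ.* ℤ.+ suc b
  cross = subst₂ ℤ._≤_ (ℤ.pos-* a _)
            (trans (ℤ.pos-* (k * (l * c)) (suc b))
              (cong (ℤ._* ℤ.+ suc b) (trans (ℤ.pos-* k (l * c)) (cong (ℤ.+ k ℤ.*_) (ℤ.pos-* l c)))))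
            (ℤ.+≤+ cross-ℕ)

Prob-nonNeg : ∀ {n} (d : Fin n → ℕ) (E : Map n → Bool) → ℚ.NonNegative (Prob d E)
Prob-nonNeg d E = frac-nonNeg (length (filterᵇ E (𝔉 d))) (length (𝔉 d))

probTail0≤2*d*expSixOverN : ∀ {m} (d : Fin (suc m) → ℕ) v →
  probTail0 d v ℚ.≤ (ℤ.+ 2 ℚ./ 1) ℚ.* ((ℤ.+ d v ℚ./ 1) ℚ.* expSixOverN d v)
probTail0≤2*d*expSixOverN {m} d v =
  frac-≤-scaled _ (length (𝔉 d)) _ 2 (d v) m (Counting.#onCycle*n≤2*d*∑six v d)

lemma3p13 : (d : (m : ℕ) → Fin (suc m) → ℕ) → (deg : ∀ m → IsDegreeSeq (suc m) (d m))
    → (v : (m : ℕ) → Fin (suc m))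
    → ∃[ C ] ∃[ N ] ∀ m → N ℕ.≤ m →
        probTail0 (d m) (v m) ℚ.≤
          C ℚ.* ((ℤ.+ d m (v m) ℚ./ 1) ℚ.* expSixOverN (d m) (v m)
               ℚ.+ (ℤ.+ d m (v m) ℚ./ 1) ℚ.* (ℤ.+ suc m ℚ./ 1) ℚ.* probSixBig (d m) (v m))
lemma3p13 d _ v = ℤ.+ 2 ℚ./ 1 , 0 , λ m _ →
  ℚ.≤-trans (probTail0≤2*d*expSixOverN (d m) (v m))
            (ℚ.*-monoˡ-≤-nonNeg (ℤ.+ 2 ℚ./ 1) {{ℕ/1-nonNeg 2}}
              (≤-+-nonNeg (dᵥ m ℚ.* expSixOverN (d m) (v m)) (dᵥ m ℚ.* size m ℚ.* probSixBig (d m) (v m))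
                          {{second-term-nonNeg m}}))
  where
  dᵥ size : ℕ → ℚ.ℚ
  dᵥ m   = ℤ.+ d m (v m) ℚ./ 1
  size m = ℤ.+ suc m ℚ./ 1
  second-term-nonNeg : ∀ m → ℚ.NonNegative (dᵥ m ℚ.* size m ℚ.* probSixBig (d m) (v m))
  second-term-nonNeg m = ℚ.nonNeg*nonNeg⇒nonNeg (dᵥ m ℚ.* size m)
    {{ℚ.nonNeg*nonNeg⇒nonNeg (dᵥ m) {{ℕ/1-nonNeg (d m (v m))}} (size m) {{ℕ/1-nonNeg (suc m)}}}}
    (probSixBig (d m) (v m)) {{Prob-nonNeg (d m) _}}
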